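{- Every cubic graph of tree-width at most 3 contains a triangle, a copy of $K_{2,3}$, or a copy of the domino as a subgraph.
   Context: All graphs are finite and simple. The domino is the graph on vertices $a_1,\dots,a_6$ with edges $a_1a_2,a_1a_5,a_2a_6,a_5a_6,a_5a_3,a_6a_4,a_3a_4$ (two 4-cycles sharing an edge). -}

module Defs where

open import Data.Nat using (ℕ; zero; suc; _≤_; _+_)
open import Data.Bool using (Bool; true; false; T)
open import Data.Fin using (Fin; zero; suc; inject₁; fromℕ)
open import Data.List using (List; []; _∷_; length; filterᵇ; allFin)
open import Data.List.Relation.Unary.All using (All)
open import Data.Product using (Σ; ∃; _×_; _,_)
open import Relation.Binary.PropositionalEquality using (_≡_)
open import Function.Definitions using (Injective)

-- vertex i of Fin h, written via fromℕ< would need proofs; use explicit names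
f0 : ∀ {h} → Fin (suc h)
f0 = zero
f1 : ∀ {h} → Fin (suc (suc h))
f1 = suc zero
f2 : ∀ {h} → Fin (suc (suc (suc h)))
f2 = suc f1
f3 : ∀ {h} → Fin (suc (suc (suc (suc h))))
f3 = suc f2
f4 : ∀ {h} → Fin (suc (suc (suc (suc (suc h)))))
f4 = suc f3
f5 : ∀ {h} → Fin (suc (suc (suc (suc (suc (suc h))))))
f5 = suc f4

record Graph (n : ℕ) : Set where
  field
    adj    : Fin n → Fin n → Bool
    sym    : ∀ u v → adj u v ≡ adj v u
    irrefl : ∀ v → adj v v ≡ false
open Graph public

Edge : ∀ {n} → Graph n → Fin n → Fin n → Set
Edge G u v = T (adj G u v)

size : ∀ {n} → (Fin n → Bool) → ℕ
size {n} S = length (filterᵇ S (allFin n))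

degree : ∀ {n} → Graph n → Fin n → ℕ
degree G v = size (adj G v)

Cubic : ∀ {n} → Graph n → Set
Cubic G = ∀ v → degree G v ≡ 3

data WalkIn {n} (G : Graph n) (P : Fin n → Set) : Fin n → Fin n → Set where
  stop : ∀ {v} → P v → WalkIn G P v v
  step : ∀ {u w v} → P u → Edge G u w → WalkIn G P w v → WalkIn G P u v

Connected : ∀ {n} → Graph n → Set
Connected G = ∀ u v → WalkIn G (λ _ → Data.Unit.⊤) u v
  where import Data.Unit

-- a cycle of length k+3: injective cyclic sequence of adjacent vertices
HasCycle : ∀ {n} → Graph n → Set
HasCycle {n} G =
  Σ ℕ λ k → Σ (Fin (suc (suc (suc k))) → Fin n) λ c →
    Injective _≡_ _≡_ c ×
    (∀ (i : Fin (suc (suc k))) → Edge G (c (inject₁ i)) (c (suc i))) ×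
    Edge G (c (fromℕ (suc (suc k)))) (c zero)

Acyclic : ∀ {n} → Graph n → Set
Acyclic G = HasCycle G → Data.Empty.⊥
  where import Data.Empty

IsTree : ∀ {m} → Graph m → Set
IsTree T = Connected T × Acyclic T

record TreeDecomposition {n} (G : Graph n) (m : ℕ) : Set where
  field
    tree    : Graph m
    isTree  : IsTree tree
    bag     : Fin m → Fin n → Bool
    coverV  : ∀ v → ∃ λ t → T (bag t v)
    coverE  : ∀ u v → Edge G u v → ∃ λ t → T (bag t u) × T (bag t v)
    subtree : ∀ v t₁ t₂ → T (bag t₁ v) → T (bag t₂ v) →
              WalkIn tree (λ t → T (bag t v)) t₁ t₂
open TreeDecomposition public

-- width = max bag size - 1
WidthAtMost : ∀ {n m} {G : Graph n} → TreeDecomposition G m → ℕ → Set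
WidthAtMost D k = ∀ t → size (bag D t) ≤ suc k

TreeWidthAtMost : ∀ {n} → Graph n → ℕ → Set
TreeWidthAtMost G k = Σ ℕ λ m → Σ (TreeDecomposition G m) λ D → WidthAtMost D k

ContainsCopy : ∀ {n} → Graph n → (h : ℕ) → List (Fin h × Fin h) → Set
ContainsCopy {n} G h es =
  Σ (Fin h → Fin n) λ f → Injective _≡_ _≡_ f ×
    All (λ { (a , b) → Edge G (f a) (f b) }) es

triangleEdges : List (Fin 3 × Fin 3)
triangleEdges = (f0 , f1) ∷ (f1 , f2) ∷ (f0 , f2) ∷ []

K23Edges : List (Fin 5 × Fin 5)
K23Edges = (f0 , f2) ∷ (f0 , f3) ∷ (f0 , f4) ∷ (f1 , f2) ∷ (f1 , f3) ∷ (f1 , f4) ∷ []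

-- domino: a_i is vertex i-1; edges a1a2,a1a5,a2a6,a5a6,a5a3,a6a4,a3a4
dominoEdges : List (Fin 6 × Fin 6)
dominoEdges = (f0 , f1) ∷ (f0 , f4) ∷ (f1 , f5) ∷ (f4 , f5) ∷ (f4 , f2) ∷ (f5 , f3) ∷ (f2 , f3) ∷ []

-- Stripping leaves off the decomposition tree orders the vertices so that every vertex x lies in
-- one bag, its clique, together with all later vertices that share a bag with x; cliques have at
-- most four vertices. Let w be the first vertex sharing a bag with an earlier vertex. A vertex x
-- before w shares bags only with later vertices, so its clique is x with its three neighbours; in
-- particular w is a neighbour of the earlier vertex it shares a bag with. For every earlier
-- neighbour x of w, the two other neighbours of x are later than w and lie in the clique of w,
-- as do the later neighbours of w, and that clique has room for only three vertices besides w.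
-- Comparing these neighbourhoods for one, two or three earlier neighbours of w yields a
-- triangle, a K₂,₃ or a domino.

module Submission where

open import Defs
open import Data.Nat using (ℕ; zero; suc; _≤_; _<_; _+_; _<?_; s≤s; s≤s⁻¹)
open import Data.Nat.Properties using (≤-trans; ≤-reflexive; 1+n≰n; +-suc; +-identityʳ; n≤1+n; <-irrefl; <-trans; <-≤-trans; <-cmp; m≤m+n; +-cancelˡ-≡; +-cancelˡ-<; n≮0)
open import Data.Bool using (Bool; true; false; T; not; _∧_; if_then_else_)
open import Data.Unit using (tt)
open import Data.Fin using (Fin; zero; suc; toℕ; inject₁; inject≤; fromℕ)
open import Data.Fin.Properties using (_≟_; any?; all?; injective⇒≤; <⇒notInjective; toℕ-injective; toℕ-inject≤; toℕ-inject₁; toℕ-fromℕ; toℕ<n; inject≤-injective)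
open import Data.List using (List; []; _∷_; length; lookup; filter; filterᵇ; allFin)
open import Data.List.Properties using (length-filter; length-tabulate)
open import Data.List.Extrema.Nat using (argmin; argmin-all; f[argmin]≤f[xs])
open import Data.List.Relation.Unary.Any as Any using (here; there; index)
open import Data.List.Relation.Unary.Any.Properties using (lookup-index)
open import Data.List.Relation.Unary.All as All using (All; []; _∷_)
open import Data.List.Relation.Unary.All.Properties using (¬Any⇒All¬; all-filter)
open import Data.List.Relation.Unary.AllPairs using ([]; _∷_)
open import Data.List.Relation.Unary.Unique.Propositional using (Unique)
open import Data.List.Relation.Unary.Unique.Propositional.Properties using (allFin⁺; filter⁺)
open import Data.List.Membership.Propositional using (_∈_)
open import Data.List.Membership.Propositional.Properties using (∈-filter⁺; ∈-filter⁻; ∈-allFin; ∈-lookup)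
open import Data.Product using (∃; _×_; _,_; proj₁; proj₂)
open import Data.Sum using (_⊎_; inj₁; inj₂)
open import Data.Empty using (⊥-elim)
open import Function using (_∘_)
open import Function.Definitions using (Injective)
open import Relation.Nullary using (¬_; Dec; does; yes; no; ¬?)
open import Relation.Nullary.Decidable using (T?; _×-dec_)
open import Relation.Binary using (tri<; tri≈; tri>)
open import Relation.Binary.PropositionalEquality as ≡ using (_≡_; _≢_; refl; cong; subst; subst₂)

Unique⇒lookup-injective : ∀ {A : Set} {xs : List A} → Unique xs → Injective _≡_ _≡_ (lookup xs)
Unique⇒lookup-injective (_ ∷ _)      {zero}  {zero}  _  = refl
Unique⇒lookup-injective (x∉xs ∷ _)   {zero}  {suc j} eq = ⊥-elim (All.lookup x∉xs (∈-lookup j) eq)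
Unique⇒lookup-injective (x∉xs ∷ _)   {suc i} {zero}  eq = ⊥-elim (All.lookup x∉xs (∈-lookup i) (≡.sym eq))
Unique⇒lookup-injective (_ ∷ xs!)    {suc i} {suc j} eq = cong suc (Unique⇒lookup-injective xs! eq)

Unique-⊆⇒length≤ : ∀ {A : Set} {xs ys : List A} → Unique xs → (∀ {x} → x ∈ xs → x ∈ ys) →
                   length xs ≤ length ys
Unique-⊆⇒length≤ {xs = xs} {ys} xs! xs⊆ys = injective⇒≤ position-injective
  where
  position : Fin (length xs) → Fin (length ys)
  position i = index (xs⊆ys (∈-lookup i))
  position-injective : Injective _≡_ _≡_ position
  position-injective {i} {j} eq = Unique⇒lookup-injective xs! (begin
    lookup xs i                 ≡⟨ lookup-index (xs⊆ys (∈-lookup i)) ⟩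
    lookup ys (position i)      ≡⟨ cong (lookup ys) eq ⟩
    lookup ys (position j)      ≡⟨ lookup-index (xs⊆ys (∈-lookup j)) ⟨
    lookup xs j                 ∎)
    where open ≡.≡-Reasoning

record TwoOthers {A : Set} (P : A → Set) (u : A) : Set where
  field
    a b : A
    Pa  : P a
    Pb  : P b
    u≢a : u ≢ a
    u≢b : u ≢ b
    a≢b : a ≢ b

length≡3⇒TwoOthers : ∀ {A : Set} {xs : List A} {u} → length xs ≡ 3 → Unique xs → u ∈ xs →
                     TwoOthers (_∈ xs) u
length≡3⇒TwoOthers {xs = a ∷ b ∷ c ∷ []} refl ((a≢b ∷ a≢c ∷ []) ∷ (b≢c ∷ []) ∷ [] ∷ []) u∈xs with u∈xs
... | here refl = record
  { a = b ; b = c ; Pa = there (here refl) ; Pb = there (there (here refl))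
  ; u≢a = a≢b ; u≢b = a≢c ; a≢b = b≢c }
... | there (here refl) = record
  { a = a ; b = c ; Pa = here refl ; Pb = there (there (here refl))
  ; u≢a = a≢b ∘ ≡.sym ; u≢b = b≢c ; a≢b = a≢c }
... | there (there (here refl)) = record
  { a = a ; b = b ; Pa = here refl ; Pb = there (here refl)
  ; u≢a = a≢c ∘ ≡.sym ; u≢b = b≢c ∘ ≡.sym ; a≢b = a≢b }

T-∧-not⁻ : ∀ {a b} → T (a ∧ not b) → T a × ¬ T b
T-∧-not⁻ {true} {false} _ = tt , λ ()

T-∧-not⁺ : ∀ {a b} → T a → ¬ T b → T (a ∧ not b)
T-∧-not⁺ {true} {false} _ _  = tt
T-∧-not⁺ {true} {true}  _ ¬b = ¬b tt

module _ {n : ℕ} where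

  members : (Fin n → Bool) → List (Fin n)
  members S = filterᵇ S (allFin n)

  ∈-members⁺ : ∀ {S v} → T (S v) → v ∈ members S
  ∈-members⁺ {S} Sv = ∈-filter⁺ (T? ∘ S) (∈-allFin _) Sv

  ∈-members⁻ : ∀ {S v} → v ∈ members S → T (S v)
  ∈-members⁻ {S} = proj₂ ∘ ∈-filter⁻ (T? ∘ S) {xs = allFin n}

  members-unique : ∀ S → Unique (members S)
  members-unique S = filter⁺ (T? ∘ S) (allFin⁺ n)

  Unique⇒length≤size : ∀ {S xs} → Unique xs → All (T ∘ S) xs → length xs ≤ size S
  Unique⇒length≤size {S} xs! xs⊆S = Unique-⊆⇒length≤ xs! (∈-members⁺ {S} ∘ All.lookup xs⊆S)

  size≤length⇒∈ : ∀ {S xs v} → Unique xs → All (T ∘ S) xs → size S ≤ length xs → T (S v) → v ∈ xs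
  size≤length⇒∈ {S} {xs} {v} xs! xs⊆S size≤ Sv with Any.any? (v ≟_) xs
  ... | yes v∈xs = v∈xs
  ... | no  v∉xs =
    ⊥-elim (1+n≰n (≤-trans (Unique⇒length≤size {S} (¬Any⇒All¬ xs v∉xs ∷ xs!) (Sv ∷ xs⊆S)) size≤))

  nonempty : ∀ {S k} → size S ≡ suc k → ∃ (T ∘ S)
  nonempty {S} size≡ with members S | ∈-members⁻ {S}
  nonempty () | [] | _
  ... | v ∷ _ | ∈⇒S = v , ∈⇒S (here refl)

  size≡3⇒TwoOthers : ∀ {S u} → size S ≡ 3 → T (S u) → TwoOthers (T ∘ S) u
  size≡3⇒TwoOthers {S} size≡3 Su = record
    { a = a ; b = b ; Pa = ∈-members⁻ {S} Pa ; Pb = ∈-members⁻ {S} Pb ; u≢a = u≢a ; u≢b = u≢b ; a≢b = a≢b }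
    where open TwoOthers (length≡3⇒TwoOthers size≡3 (members-unique S) (∈-members⁺ {S} Su))

  size≤n : ∀ S → size S ≤ n
  size≤n S = ≤-trans (length-filter (T? ∘ S) (allFin n)) (≤-reflexive (length-tabulate _))

  _─_ : (Fin n → Bool) → Fin n → Fin n → Bool
  (S ─ a) v = if does (v ≟ a) then false else S v

  ∈-─⁺ : ∀ {S a v} → T (S v) → v ≢ a → T ((S ─ a) v)
  ∈-─⁺ {a = a} {v} Sv v≢a with v ≟ a
  ... | yes v≡a = ⊥-elim (v≢a v≡a)
  ... | no  _   = Sv

  ∈-─⁻ : ∀ {S a v} → T ((S ─ a) v) → T (S v) × v ≢ a
  ∈-─⁻ {a = a} {v} Sv with v ≟ a
  ... | no v≢a = Sv , v≢a

  size-─ : ∀ {S a} → T (S a) → size (S ─ a) < size S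
  size-─ {S} {a} Sa =
    Unique⇒length≤size {S} (All.tabulate (λ v∈ → proj₂ (remaining v∈) ∘ ≡.sym) ∷ members-unique (S ─ a))
                           (Sa ∷ All.tabulate (proj₁ ∘ remaining))
    where
    remaining : ∀ {v} → v ∈ members (S ─ a) → T (S v) × v ≢ a
    remaining = ∈-─⁻ {S} ∘ ∈-members⁻ {S ─ a}

module GraphFacts {n} (G : Graph n) where

  Edge-sym : ∀ {u v} → Edge G u v → Edge G v u
  Edge-sym {u} {v} = subst T (Graph.sym G u v)

  Edge⇒≢ : ∀ {u v} → Edge G u v → u ≢ v
  Edge⇒≢ {u} e refl = subst T (irrefl G u) e

  Edge? : ∀ u v → Dec (Edge G u v)
  Edge? u v = T? (adj G u v)

  non-neighbour≢neighbour : ∀ {x p q} → ¬ Edge G x p → Edge G x q → p ≢ q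
  non-neighbour≢neighbour ¬xp xq refl = ¬xp xq

module _ {m} {Tr : Graph m} where
  open GraphFacts Tr

  WalkIn-head : ∀ {P : Fin m → Set} {u v} → WalkIn Tr P u v → P u
  WalkIn-head (stop Pu)     = Pu
  WalkIn-head (step Pu _ _) = Pu

  WalkIn-map : ∀ {P Q : Fin m → Set} → (∀ {u} → P u → Q u) → ∀ {u v} → WalkIn Tr P u v → WalkIn Tr Q u v
  WalkIn-map f (stop Pu)         = stop (f Pu)
  WalkIn-map f (step Pu uw walk) = step (f Pu) uw (WalkIn-map f walk)

  -- A walk through ℓ enters and leaves it via p, so that detour can be cut out.
  avoid-leaf : ∀ {P : Fin m → Set} {ℓ p} → (∀ {u} → P u → Edge Tr ℓ u → u ≡ p) →
               ∀ {s t} → WalkIn Tr P s t → s ≢ ℓ → t ≢ ℓ → WalkIn Tr (λ u → P u × u ≢ ℓ) s t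
  avoid-leaf only-p (stop Ps) s≢ℓ _ = stop (Ps , s≢ℓ)
  avoid-leaf {ℓ = ℓ} only-p (step {w = u} Ps su walk) s≢ℓ t≢ℓ with u ≟ ℓ
  ... | no u≢ℓ = step (Ps , s≢ℓ) su (avoid-leaf only-p walk u≢ℓ t≢ℓ)
  avoid-leaf only-p (step Ps sℓ (stop _)) s≢ℓ t≢ℓ | yes refl = ⊥-elim (t≢ℓ refl)
  avoid-leaf only-p (step Ps sℓ (step _ ℓu walk)) s≢ℓ t≢ℓ | yes refl
    with only-p Ps (Edge-sym sℓ) | only-p (WalkIn-head walk) ℓu
  ... | refl | refl = avoid-leaf only-p walk s≢ℓ t≢ℓ

  chord⇒HasCycle : ∀ {k} (c : Fin (suc (suc k)) → Fin m) → Injective _≡_ _≡_ c →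
                   (∀ i → Edge Tr (c (inject₁ i)) (c (suc i))) →
                   ∀ j → Edge Tr (c (suc (suc j))) (c zero) → HasCycle Tr
  chord⇒HasCycle {k} c c-injective steps j closing =
    toℕ j , cycle , cycle-injective , cycle-steps , cycle-closing
    where
    open ≡.≡-Reasoning
    prefix : suc (suc (suc (toℕ j))) ≤ suc (suc k)
    prefix = s≤s (s≤s (toℕ<n j))
    cycle : Fin (suc (suc (suc (toℕ j)))) → Fin m
    cycle i = c (inject≤ i prefix)
    cycle-injective : Injective _≡_ _≡_ cycle
    cycle-injective eq = inject≤-injective prefix prefix _ _ (c-injective eq)
    inject₁-inject≤ : ∀ i → inject₁ (inject≤ i (s≤s (toℕ<n j))) ≡ inject≤ (inject₁ i) prefix
    inject₁-inject≤ i = toℕ-injective (begin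
      toℕ (inject₁ (inject≤ i _))      ≡⟨ toℕ-inject₁ _ ⟩
      toℕ (inject≤ i _)                ≡⟨ toℕ-inject≤ i _ ⟩
      toℕ i                            ≡⟨ toℕ-inject₁ i ⟨
      toℕ (inject₁ i)                  ≡⟨ toℕ-inject≤ (inject₁ i) prefix ⟨
      toℕ (inject≤ (inject₁ i) prefix) ∎)
    cycle-steps : ∀ i → Edge Tr (cycle (inject₁ i)) (cycle (suc i))
    cycle-steps i = subst (λ a → Edge Tr (c a) (cycle (suc i))) (inject₁-inject≤ i) (steps _)
    last≡ : suc (suc j) ≡ inject≤ (fromℕ (suc (suc (toℕ j)))) prefix
    last≡ = toℕ-injective (begin
      suc (suc (toℕ j))                                ≡⟨ toℕ-fromℕ _ ⟨
      toℕ (fromℕ (suc (suc (toℕ j))))                  ≡⟨ toℕ-inject≤ _ prefix ⟨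
      toℕ (inject≤ (fromℕ (suc (suc (toℕ j)))) prefix) ∎)
    cycle-closing : Edge Tr (cycle (fromℕ _)) (cycle zero)
    cycle-closing = subst (λ a → Edge Tr (c a) (c zero)) last≡ closing

record Leaf {m} (Tr : Graph m) (A : Fin m → Bool) : Set where
  field
    ℓ p     : Fin m
    alive-ℓ : T (A ℓ)
    alive-p : T (A p)
    ℓ-p     : Edge Tr ℓ p
    only-p  : ∀ {u} → T (A u) → Edge Tr ℓ u → u ≡ p

module _ {m} {Tr : Graph m} (acyclic : Acyclic Tr) (A : Fin m → Bool) where

  record AlivePath : Set where
    field
      k           : ℕ
      c           : Fin (suc (suc k)) → Fin m
      c-injective : Injective _≡_ _≡_ c
      alive       : ∀ i → T (A (c i))
      steps       : ∀ i → Edge Tr (c (inject₁ i)) (c (suc i))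

  open AlivePath
  open GraphFacts Tr

  edge-path : ∀ {s t} → T (A s) → T (A t) → Edge Tr s t → AlivePath
  edge-path {s} {t} As At st =
    record { k = 0 ; c = c′ ; c-injective = c′-injective ; alive = alive′ ; steps = λ { zero → st } }
    where
    c′ : Fin 2 → Fin m
    c′ zero       = s
    c′ (suc zero) = t
    c′-injective : Injective _≡_ _≡_ c′
    c′-injective {zero}     {zero}     _  = refl
    c′-injective {zero}     {suc zero} eq = ⊥-elim (Edge⇒≢ st eq)
    c′-injective {suc zero} {zero}     eq = ⊥-elim (Edge⇒≢ st (≡.sym eq))
    c′-injective {suc zero} {suc zero} _  = refl
    alive′ : ∀ i → T (A (c′ i))
    alive′ zero       = As
    alive′ (suc zero) = At

  prepend : (P : AlivePath) → ∀ {u} → T (A u) → Edge Tr (c P zero) u → (∀ i → c P i ≢ u) → AlivePath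
  prepend P {u} Au c₀u fresh =
    record { k = suc (k P) ; c = c′ ; c-injective = c′-injective ; alive = alive′ ; steps = steps′ }
    where
    c′ : Fin (suc (suc (suc (k P)))) → Fin m
    c′ zero    = u
    c′ (suc i) = c P i
    c′-injective : Injective _≡_ _≡_ c′
    c′-injective {zero}  {zero}  _  = refl
    c′-injective {zero}  {suc j} eq = ⊥-elim (fresh j (≡.sym eq))
    c′-injective {suc i} {zero}  eq = ⊥-elim (fresh i eq)
    c′-injective {suc i} {suc j} eq = cong suc (c-injective P eq)
    alive′ : ∀ i → T (A (c′ i))
    alive′ zero    = Au
    alive′ (suc i) = alive P i
    steps′ : ∀ i → Edge Tr (c′ (inject₁ i)) (c′ (suc i))
    steps′ zero    = Edge-sym c₀u
    steps′ (suc i) = steps P i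

  -- An endpoint all of whose alive neighbours lie on the path is a leaf: a neighbour further
  -- along than the second vertex would close a cycle.
  endpoint-leaf : (P : AlivePath) → (∀ {u} → T (A u) → Edge Tr (c P zero) u → ∃ λ i → c P i ≡ u) →
                  Leaf Tr A
  endpoint-leaf P on-path = record
    { ℓ = c P zero ; p = c P (suc zero) ; alive-ℓ = alive P zero ; alive-p = alive P (suc zero)
    ; ℓ-p = steps P zero ; only-p = only-p }
    where
    only-p : ∀ {u} → T (A u) → Edge Tr (c P zero) u → u ≡ c P (suc zero)
    only-p Au c₀u with on-path Au c₀u
    ... | zero , refl        = ⊥-elim (Edge⇒≢ c₀u refl)
    ... | suc zero , refl    = refl
    ... | suc (suc j) , refl =
      ⊥-elim (acyclic (chord⇒HasCycle {Tr = Tr} (c P) (c-injective P) (steps P) j (Edge-sym c₀u)))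

  grow : ∀ fuel (P : AlivePath) → m < suc (suc (k P)) + fuel → Leaf Tr A
  grow zero P m<len = ⊥-elim (<⇒notInjective (subst (m <_) (+-identityʳ _) m<len) (c-injective P))
  grow (suc fuel) P m<len
    with any? (λ u → T? (A u) ×-dec T? (adj Tr (c P zero) u) ×-dec all? (λ i → ¬? (c P i ≟ u)))
  ... | yes (u , Au , c₀u , fresh) = grow fuel (prepend P Au c₀u fresh) (subst (m <_) (+-suc _ fuel) m<len)
  ... | no stuck = endpoint-leaf P on-path
    where
    on-path : ∀ {u} → T (A u) → Edge Tr (c P zero) u → ∃ λ i → c P i ≡ u
    on-path {u} Au c₀u with any? (λ i → c P i ≟ u)
    ... | yes found = found
    ... | no absent = ⊥-elim (stuck (u , Au , c₀u , λ i eq → absent (i , eq)))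

  leaf-exists : ∀ {s t} → T (A s) → T (A t) → Edge Tr s t → Leaf Tr A
  leaf-exists As At st = grow m (edge-path As At st) (s≤s (n≤1+n m))

-- _~_ is a chordal supergraph of G (for a tree decomposition: sharing a bag) and rank is a perfect
-- elimination ordering of it whose cliques have at most k + 1 vertices.
record EliminationOrdering {n} (G : Graph n) (k : ℕ) : Set₁ where
  field
    _~_            : Fin n → Fin n → Set
    _~?_           : ∀ u v → Dec (u ~ v)
    Edge⇒~         : ∀ {u v} → Edge G u v → u ~ v
    rank           : Fin n → ℕ
    rank-injective : Injective _≡_ _≡_ rank
    clique         : Fin n → Fin n → Bool
    clique-size    : ∀ x → size (clique x) ≤ suc k
    clique-self    : ∀ x → T (clique x x)
    clique-~       : ∀ x {u v} → T (clique x u) → T (clique x v) → u ~ v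
    later⊆clique   : ∀ {x y} → x ~ y → rank x < rank y → T (clique x y)

module _ {n m} {G : Graph n} (D : TreeDecomposition G m) where

  Shares : Fin n → Fin n → Set
  Shares u v = ∃ λ t → T (bag D t u) × T (bag D t v)

  -- Invariant of leaf stripping: A are the remaining tree nodes, R the vertices still to be ordered,
  -- and the bags at A form a tree decomposition of R under Shares.
  record SubDecomposition (A : Fin m → Bool) (R : Fin n → Bool) : Set where
    field
      connected : ∀ {s t} → T (A s) → T (A t) → WalkIn (tree D) (T ∘ A) s t
      covered   : ∀ {v} → T (R v) → ∃ λ t → T (A t) × T (bag D t v)
      shared    : ∀ {u v} → T (R u) → T (R v) → Shares u v →
                  ∃ λ t → T (A t) × T (bag D t u) × T (bag D t v)
      bags-connected : ∀ {v s t} → T (R v) → T (A s) → T (A t) → T (bag D s v) → T (bag D t v) →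
                       WalkIn (tree D) (λ t → T (A t) × T (bag D t v)) s t

  HomeBag : (Fin n → Bool) → (Fin n → ℕ) → Fin n → Set
  HomeBag R rank x = ∃ λ t → T (bag D t x) × (∀ {y} → T (R y) → Shares x y → rank x < rank y → T (bag D t y))

  record Ordering (R : Fin n → Bool) : Set where
    field
      rank           : Fin n → ℕ
      rank-injective : ∀ {u v} → T (R u) → T (R v) → rank u ≡ rank v → u ≡ v
      home           : ∀ {x} → T (R x) → HomeBag R rank x

  order-without-edges : ∀ {A R} → SubDecomposition A R → (∀ {s t} → T (A s) → T (A t) → ¬ Edge (tree D) s t) →
                        Ordering R
  order-without-edges {A} {R} sub no-edge =
    record { rank = toℕ ; rank-injective = λ _ _ → toℕ-injective ; home = home }
    where
    open SubDecomposition sub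
    trivial : ∀ {s t} → WalkIn (tree D) (T ∘ A) s t → s ≡ t
    trivial (stop _)          = refl
    trivial (step As st walk) = ⊥-elim (no-edge As (WalkIn-head walk) st)
    home : ∀ {x} → T (R x) → HomeBag R toℕ x
    home {x} Rx with covered Rx
    ... | t , At , tx = t , tx , λ Ry x~y _ → later Ry x~y
      where
      later : ∀ {y} → T (R y) → Shares x y → T (bag D t y)
      later {y} Ry x~y with shared Rx Ry x~y
      ... | t′ , At′ , _ , t′y = subst (λ s → T (bag D s y)) (≡.sym (trivial (connected At At′))) t′y

  -- Removing the leaf ℓ also removes the vertices that occur in bag ℓ but not in bag p: by the
  -- subtree property ℓ is their only alive bag, so they are ordered first, with ℓ as home bag.
  module Strip {A R} (sub : SubDecomposition A R) (leaf : Leaf (tree D) A) where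
    open SubDecomposition sub
    open Leaf leaf
    open GraphFacts (tree D)

    A′ : Fin m → Bool
    A′ = A ─ ℓ

    R′ : Fin n → Bool
    R′ v = R v ∧ not (bag D ℓ v ∧ not (bag D p v))

    p≢ℓ : p ≢ ℓ
    p≢ℓ p≡ℓ = Edge⇒≢ ℓ-p (≡.sym p≡ℓ)

    kept⇒R : ∀ {v} → T (R′ v) → T (R v)
    kept⇒R = proj₁ ∘ T-∧-not⁻

    kept⇒in-p : ∀ {v} → T (R′ v) → T (bag D ℓ v) → T (bag D p v)
    kept⇒in-p {v} kept ℓv with T? (bag D p v)
    ... | yes pv  = pv
    ... | no ¬pv = ⊥-elim (proj₂ (T-∧-not⁻ kept) (T-∧-not⁺ ℓv ¬pv))

    dropped⇒private : ∀ {v} → T (R v) → ¬ T (R′ v) → T (bag D ℓ v) × ¬ T (bag D p v)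
    dropped⇒private {v} Rv ¬kept with T? (bag D ℓ v ∧ not (bag D p v))
    ... | yes private-v = T-∧-not⁻ private-v
    ... | no ¬private-v = ⊥-elim (¬kept (T-∧-not⁺ Rv ¬private-v))

    dropped-only-in-ℓ : ∀ {v t} → T (R v) → ¬ T (R′ v) → T (A t) → T (bag D t v) → t ≡ ℓ
    dropped-only-in-ℓ Rv ¬kept At tv with bags-connected Rv alive-ℓ At (proj₁ (dropped⇒private Rv ¬kept)) tv
    ... | stop _         = refl
    ... | step _ ℓu walk with only-p (proj₁ (WalkIn-head walk)) ℓu
    ...   | refl = ⊥-elim (proj₂ (dropped⇒private Rv ¬kept) (proj₂ (WalkIn-head walk)))

    move-off-ℓ : ∀ {t} → T (A t) → ∃ λ t′ → T (A′ t′) × (∀ {v} → T (R′ v) → T (bag D t v) → T (bag D t′ v))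
    move-off-ℓ {t} At with t ≟ ℓ
    ... | yes refl = p , ∈-─⁺ {S = A} alive-p p≢ℓ , kept⇒in-p
    ... | no  t≢ℓ  = t , ∈-─⁺ {S = A} At t≢ℓ , λ _ tv → tv

    shrink : ∀ {P : Fin m → Set} → (∀ {u} → P u → T (A u)) → ∀ {s t} → WalkIn (tree D) P s t →
             T (A′ s) → T (A′ t) → WalkIn (tree D) (λ u → P u × T (A′ u)) s t
    shrink P⇒A walk A′s A′t =
      WalkIn-map (λ { (Pu , u≢ℓ) → Pu , ∈-─⁺ {S = A} (P⇒A Pu) u≢ℓ })
        (avoid-leaf (only-p ∘ P⇒A) walk (proj₂ (∈-─⁻ {S = A} A′s)) (proj₂ (∈-─⁻ {S = A} A′t)))

    sub′ : SubDecomposition A′ R′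
    sub′ = record
      { connected      = λ A′s A′t →
          WalkIn-map proj₂ (shrink (λ Au → Au) (connected (alive A′s) (alive A′t)) A′s A′t)
      ; covered        = λ kept →
          let t , At , tv = covered (kept⇒R kept) ; t′ , A′t′ , move = move-off-ℓ At
          in  t′ , A′t′ , move kept tv
      ; shared         = λ keptu keptv u~v →
          let t , At , tu , tv = shared (kept⇒R keptu) (kept⇒R keptv) u~v ; t′ , A′t′ , move = move-off-ℓ At
          in  t′ , A′t′ , move keptu tu , move keptv tv
      ; bags-connected = λ kept A′s A′t sv tv →
          WalkIn-map (λ { ((_ , uv) , A′u) → A′u , uv })
            (shrink proj₁ (bags-connected (kept⇒R kept) (alive A′s) (alive A′t) sv tv) A′s A′t)
      }
      where
      alive : ∀ {t} → T (A′ t) → T (A t)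
      alive = proj₁ ∘ ∈-─⁻ {S = A}

    module Lift (O′ : Ordering R′) where
      open Ordering O′ renaming (rank to rank′; rank-injective to rank′-injective; home to home′)

      rank : Fin n → ℕ
      rank x = if R′ x then n + rank′ x else toℕ x

      rank-kept : ∀ {x} → T (R′ x) → rank x ≡ n + rank′ x
      rank-kept {x} kept with R′ x
      ... | true = refl

      rank-dropped : ∀ {x} → ¬ T (R′ x) → rank x ≡ toℕ x
      rank-dropped {x} ¬kept with R′ x
      ... | true  = ⊥-elim (¬kept tt)
      ... | false = refl

      dropped<kept : ∀ {x y} → ¬ T (R′ x) → T (R′ y) → rank x < rank y
      dropped<kept {x} ¬keptx kepty =
        subst₂ _<_ (≡.sym (rank-dropped ¬keptx)) (≡.sym (rank-kept kepty)) (<-≤-trans (toℕ<n x) (m≤m+n n _))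

      rank-injective : ∀ {u v} → T (R u) → T (R v) → rank u ≡ rank v → u ≡ v
      rank-injective {u} {v} _ _ eq with T? (R′ u) | T? (R′ v)
      ... | yes keptu | yes keptv = rank′-injective keptu keptv
            (+-cancelˡ-≡ n _ _ (≡.trans (≡.sym (rank-kept keptu)) (≡.trans eq (rank-kept keptv))))
      ... | no ¬keptu | no ¬keptv =
            toℕ-injective (≡.trans (≡.sym (rank-dropped ¬keptu)) (≡.trans eq (rank-dropped ¬keptv)))
      ... | yes keptu | no ¬keptv = ⊥-elim (<-irrefl (≡.sym eq) (dropped<kept ¬keptv keptu))
      ... | no ¬keptu | yes keptv = ⊥-elim (<-irrefl eq (dropped<kept ¬keptu keptv))

      home-kept : ∀ {x} → T (R′ x) → HomeBag R rank x
      home-kept {x} keptx with home′ keptx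
      ... | t , tx , later′ = t , tx , later
        where
        later : ∀ {y} → T (R y) → Shares x y → rank x < rank y → T (bag D t y)
        later {y} Ry x~y x<y with T? (R′ y)
        ... | yes kepty = later′ kepty x~y (+-cancelˡ-< n _ _ (subst₂ _<_ (rank-kept keptx) (rank-kept kepty) x<y))
        ... | no ¬kepty = ⊥-elim (<-irrefl refl (<-trans x<y (dropped<kept ¬kepty keptx)))

      home-dropped : ∀ {x} → T (R x) → ¬ T (R′ x) → HomeBag R rank x
      home-dropped {x} Rx ¬keptx = ℓ , proj₁ (dropped⇒private Rx ¬keptx) , λ Ry x~y _ → later Ry x~y
        where
        later : ∀ {y} → T (R y) → Shares x y → T (bag D ℓ y)
        later {y} Ry x~y with shared Rx Ry x~y
        ... | t , At , tx , ty = subst (λ s → T (bag D s y)) (dropped-only-in-ℓ Rx ¬keptx At tx) ty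

      home : ∀ {x} → T (R x) → HomeBag R rank x
      home {x} Rx with T? (R′ x)
      ... | yes keptx = home-kept keptx
      ... | no ¬keptx = home-dropped Rx ¬keptx

    lift : Ordering R′ → Ordering R
    lift O′ = record { rank = rank ; rank-injective = rank-injective ; home = home }
      where open Lift O′

  order : ∀ k {A R} → size A < k → SubDecomposition A R → Ordering R
  order zero    size<0 _ = ⊥-elim (n≮0 size<0)
  order (suc k) {A} size<k sub
    with any? (λ s → any? (λ t → T? (A s) ×-dec T? (A t) ×-dec T? (adj (tree D) s t)))
  ... | no no-edge = order-without-edges sub (λ As At st → no-edge (_ , _ , As , At , st))
  ... | yes (s , t , As , At , st) with leaf-exists (proj₂ (isTree D)) A As At st
  ...   | leaf = Strip.lift sub leaf (order k size′<k (Strip.sub′ sub leaf))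
    where
    size′<k : size (A ─ Leaf.ℓ leaf) < k
    size′<k = <-≤-trans (size-─ {S = A} (Leaf.alive-ℓ leaf)) (s≤s⁻¹ size<k)

treeDecomposition⇒EliminationOrdering : ∀ {n m k} {G : Graph n} (D : TreeDecomposition G m) → WidthAtMost D k →
                                        EliminationOrdering G k
treeDecomposition⇒EliminationOrdering {n} {m} D width = record
  { _~_            = Shares D
  ; _~?_           = λ u v → any? (λ t → T? (bag D t u) ×-dec T? (bag D t v))
  ; Edge⇒~         = λ {u} {v} → coverE D u v
  ; rank           = rank
  ; rank-injective = rank-injective tt tt
  ; clique         = bag D ∘ home-node
  ; clique-size    = width ∘ home-node
  ; clique-self    = λ x → proj₁ (proj₂ (home {x} tt))
  ; clique-~       = λ x xu xv → home-node x , xu , xv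
  ; later⊆clique   = λ x~y x<y → proj₂ (proj₂ (home tt)) tt x~y x<y
  }
  where
  whole : SubDecomposition D (λ _ → true) (λ _ → true)
  whole = record
    { connected      = λ _ _ → WalkIn-map (λ _ → tt) (proj₁ (isTree D) _ _)
    ; covered        = λ {v} _ → let t , tv = coverV D v in t , tt , tv
    ; shared         = λ _ _ u~v → let t , tu , tv = u~v in t , tt , tu , tv
    ; bags-connected = λ {v} {s} {t} _ _ _ sv tv → WalkIn-map (tt ,_) (subtree D v s t sv tv)
    }
  open Ordering (order D (suc m) (s≤s (size≤n _)) whole)
  home-node : Fin n → Fin m
  home-node x = proj₁ (home {x} tt)

TriangleK23OrDomino : ∀ {n} → Graph n → Set
TriangleK23OrDomino G = ContainsCopy G 3 triangleEdges ⊎ ContainsCopy G 5 K23Edges ⊎ ContainsCopy G 6 dominoEdges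

module Copies {n} (G : Graph n) where
  open GraphFacts G

  copy : ∀ (vs : List (Fin n)) {es} → Unique vs →
         All (λ { (a , b) → Edge G (lookup vs a) (lookup vs b) }) es → ContainsCopy G (length vs) es
  copy vs vs! edges = lookup vs , Unique⇒lookup-injective vs! , edges

  triangle : ∀ {a b c} → Edge G a b → Edge G b c → Edge G a c → TriangleK23OrDomino G
  triangle ab bc ac = inj₁ (copy (_ ∷ _ ∷ _ ∷ [])
    ((Edge⇒≢ ab ∷ Edge⇒≢ ac ∷ []) ∷ (Edge⇒≢ bc ∷ []) ∷ [] ∷ [])
    (ab ∷ bc ∷ ac ∷ []))

  K23 : ∀ {p q r s t} → Edge G p r → Edge G p s → Edge G p t → Edge G q r → Edge G q s → Edge G q t →
        p ≢ q → r ≢ s → r ≢ t → s ≢ t → TriangleK23OrDomino G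
  K23 pr ps pt qr qs qt p≢q r≢s r≢t s≢t = inj₂ (inj₁ (copy (_ ∷ _ ∷ _ ∷ _ ∷ _ ∷ [])
    ( (p≢q ∷ Edge⇒≢ pr ∷ Edge⇒≢ ps ∷ Edge⇒≢ pt ∷ [])
    ∷ (Edge⇒≢ qr ∷ Edge⇒≢ qs ∷ Edge⇒≢ qt ∷ [])
    ∷ (r≢s ∷ r≢t ∷ []) ∷ (s≢t ∷ []) ∷ [] ∷ [])
    (pr ∷ ps ∷ pt ∷ qr ∷ qs ∷ qt ∷ [])))

  -- the domino drawn as a 3 × 2 grid with rows a₁ a₂ / a₅ a₆ / a₃ a₄
  domino : ∀ {a₁ a₂ a₃ a₄ a₅ a₆} →
           Edge G a₁ a₂ → Edge G a₁ a₅ → Edge G a₂ a₆ → Edge G a₅ a₆ →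
           Edge G a₅ a₃ → Edge G a₆ a₄ → Edge G a₃ a₄ →
           a₁ ≢ a₃ → a₁ ≢ a₄ → a₁ ≢ a₆ → a₂ ≢ a₃ → a₂ ≢ a₄ → a₂ ≢ a₅ → a₃ ≢ a₆ → a₄ ≢ a₅ →
           TriangleK23OrDomino G
  domino e₁₂ e₁₅ e₂₆ e₅₆ e₅₃ e₆₄ e₃₄ a₁≢a₃ a₁≢a₄ a₁≢a₆ a₂≢a₃ a₂≢a₄ a₂≢a₅ a₃≢a₆ a₄≢a₅ =
    inj₂ (inj₂ (copy (_ ∷ _ ∷ _ ∷ _ ∷ _ ∷ _ ∷ [])
      ( (Edge⇒≢ e₁₂ ∷ a₁≢a₃ ∷ a₁≢a₄ ∷ Edge⇒≢ e₁₅ ∷ a₁≢a₆ ∷ [])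
      ∷ (a₂≢a₃ ∷ a₂≢a₄ ∷ a₂≢a₅ ∷ Edge⇒≢ e₂₆ ∷ [])
      ∷ (Edge⇒≢ e₃₄ ∷ Edge⇒≢ (Edge-sym e₅₃) ∷ a₃≢a₆ ∷ [])
      ∷ (a₄≢a₅ ∷ Edge⇒≢ (Edge-sym e₆₄) ∷ [])
      ∷ (Edge⇒≢ e₅₆ ∷ []) ∷ [] ∷ [])
      (e₁₂ ∷ e₁₅ ∷ e₂₆ ∷ e₅₆ ∷ e₅₃ ∷ e₆₄ ∷ e₃₄ ∷ [])))

module _ {n} {G : Graph n} (cubic : Cubic G) (E : EliminationOrdering G 3) where
  open EliminationOrdering E
  open GraphFacts G
  open Copies G

  rank<⇒≢ : ∀ {u v} → rank u < rank v → u ≢ v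
  rank<⇒≢ u<v refl = <-irrefl refl u<v

  HasPredecessor : Fin n → Set
  HasPredecessor w = ∃ λ x → rank x < rank w × x ~ w

  module FirstWithPredecessor (w : Fin n) (first : ∀ {v} → HasPredecessor v → rank w ≤ rank v) where

    Early : Fin n → Set
    Early x = rank x < rank w

    Upper : Fin n → Set
    Upper v = rank w < rank v × T (clique w v)

    early≢upper : ∀ {x v} → Early x → Upper v → x ≢ v
    early≢upper x<w (w<v , _) = rank<⇒≢ (<-trans x<w w<v)

    w≢upper : ∀ {v} → Upper v → w ≢ v
    w≢upper (w<v , _) = rank<⇒≢ w<v

    early-has-no-predecessor : ∀ {x} → Early x → ¬ HasPredecessor x
    early-has-no-predecessor x<w pred = <-irrefl refl (<-≤-trans x<w (first pred))

    early-forward : ∀ {x y} → Early x → Edge G x y → rank x < rank y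
    early-forward {x} {y} x<w xy with <-cmp (rank x) (rank y)
    ... | tri< x<y _ _ = x<y
    ... | tri≈ _ x≡y _ = ⊥-elim (Edge⇒≢ xy (rank-injective x≡y))
    ... | tri> _ _ y<x = ⊥-elim (early-has-no-predecessor x<w (y , y<x , Edge⇒~ (Edge-sym xy)))

    early-neighbour∈clique : ∀ {x y} → Early x → Edge G x y → T (clique x y)
    early-neighbour∈clique x<w xy = later⊆clique (Edge⇒~ xy) (early-forward x<w xy)

    -- clique x already holds x and its three neighbours, so w must be one of them.
    early-~⇒Edge : ∀ {x} → Early x → x ~ w → Edge G x w
    early-~⇒Edge {x} x<w x~w =
      neighbour (size≤length⇒∈ {S = clique x} distinct members∈clique size≤ (later⊆clique x~w x<w))
      where
      distinct : Unique (x ∷ members (adj G x))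
      distinct = All.tabulate (Edge⇒≢ ∘ ∈-members⁻ {S = adj G x}) ∷ members-unique (adj G x)
      members∈clique : All (T ∘ clique x) (x ∷ members (adj G x))
      members∈clique = clique-self x ∷ All.tabulate (early-neighbour∈clique x<w ∘ ∈-members⁻ {S = adj G x})
      size≤ : size (clique x) ≤ suc (size (adj G x))
      size≤ = subst (size (clique x) ≤_) (cong suc (≡.sym (cubic x))) (clique-size x)
      neighbour : w ∈ x ∷ members (adj G x) → Edge G x w
      neighbour (here w≡x)  = ⊥-elim (rank<⇒≢ x<w (≡.sym w≡x))
      neighbour (there w∈N) = ∈-members⁻ {S = adj G x} w∈N

    late-neighbour-upper : ∀ {y} → Edge G w y → rank w < rank y → Upper y
    late-neighbour-upper wy w<y = w<y , later⊆clique (Edge⇒~ wy) w<y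

    early-neighbour-upper : ∀ {x v} → Early x → Edge G w x → Edge G x v → v ≢ w → Upper v
    early-neighbour-upper {x} {v} x<w wx xv v≢w with <-cmp (rank v) (rank w)
    ... | tri< v<w _ _ = ⊥-elim (early-has-no-predecessor v<w (x , early-forward x<w xv , Edge⇒~ xv))
    ... | tri≈ _ v≡w _ = ⊥-elim (v≢w (rank-injective v≡w))
    ... | tri> _ _ w<v = w<v , later⊆clique (clique-~ x w∈clique (early-neighbour∈clique x<w xv)) w<v
      where
      w∈clique : T (clique x w)
      w∈clique = later⊆clique (Edge⇒~ (Edge-sym wx)) x<w

    upper-covered : ∀ {p q r v} → Upper p → Upper q → Upper r → p ≢ q → p ≢ r → q ≢ r → Upper v →
                    v ∈ p ∷ q ∷ r ∷ []
    upper-covered {p} {q} {r} {v} up@(_ , Wp) uq@(_ , Wq) ur@(_ , Wr) p≢q p≢r q≢r (w<v , Wv) =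
      drop-w (size≤length⇒∈ {S = clique w} distinct (clique-self w ∷ Wp ∷ Wq ∷ Wr ∷ []) (clique-size w) Wv)
      where
      distinct : Unique (w ∷ p ∷ q ∷ r ∷ [])
      distinct = (w≢upper up ∷ w≢upper uq ∷ w≢upper ur ∷ []) ∷ (p≢q ∷ p≢r ∷ []) ∷ (q≢r ∷ []) ∷ [] ∷ []
      drop-w : v ∈ w ∷ p ∷ q ∷ r ∷ [] → v ∈ p ∷ q ∷ r ∷ []
      drop-w (here v≡w)   = ⊥-elim (rank<⇒≢ w<v (≡.sym v≡w))
      drop-w (there v∈pqr) = v∈pqr

    record EarlyNeighbour (x : Fin n) : Set where
      field
        early    : Early x
        adjacent : Edge G w x
        a b      : Fin n
        x-a      : Edge G x a
        x-b      : Edge G x b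
        a≢b      : a ≢ b
        upper-a  : Upper a
        upper-b  : Upper b

    early-neighbour : ∀ {x} → Early x → Edge G w x → EarlyNeighbour x
    early-neighbour {x} x<w wx = record
      { early = x<w ; adjacent = wx ; a = a ; b = b ; x-a = Pa ; x-b = Pb ; a≢b = a≢b
      ; upper-a = early-neighbour-upper x<w wx Pa (u≢a ∘ ≡.sym)
      ; upper-b = early-neighbour-upper x<w wx Pb (u≢b ∘ ≡.sym) }
      where open TwoOthers (size≡3⇒TwoOthers {S = adj G x} (cubic x) (Edge-sym wx))

    misses-one⇒hits-others : ∀ {x p q r} → EarlyNeighbour x → Upper p → Upper q → Upper r →
                             p ≢ q → p ≢ r → q ≢ r → ¬ Edge G x p → Edge G x q × Edge G x r
    misses-one⇒hits-others record { x-a = x-a ; x-b = x-b ; a≢b = a≢b ; upper-a = ua ; upper-b = ub }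
                           up uq ur p≢q p≢r q≢r ¬xp
      with upper-covered up uq ur p≢q p≢r q≢r ua | upper-covered up uq ur p≢q p≢r q≢r ub
    ... | here refl                 | _                         = ⊥-elim (¬xp x-a)
    ... | _                         | here refl                 = ⊥-elim (¬xp x-b)
    ... | there (here refl)         | there (here refl)         = ⊥-elim (a≢b refl)
    ... | there (here refl)         | there (there (here refl)) = x-a , x-b
    ... | there (there (here refl)) | there (here refl)         = x-b , x-a
    ... | there (there (here refl)) | there (there (here refl)) = ⊥-elim (a≢b refl)

    K23-at-w : ∀ {x x′ s t} → EarlyNeighbour x → EarlyNeighbour x′ → x ≢ x′ →
               Edge G x s → Edge G x t → Edge G x′ s → Edge G x′ t → Upper s → Upper t → s ≢ t →
               TriangleK23OrDomino G
    K23-at-w ex ex′ x≢x′ xs xt x′s x′t us ut s≢t =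
      K23 (Edge-sym (adjacent ex)) xs xt (Edge-sym (adjacent ex′)) x′s x′t
          x≢x′ (w≢upper us) (w≢upper ut) s≢t
      where open EarlyNeighbour

    record Shared (x₁ x₂ : Fin n) : Set where
      field
        c d₁ d₂  : Fin n
        x₁-c     : Edge G x₁ c
        x₁-d₁    : Edge G x₁ d₁
        x₂-c     : Edge G x₂ c
        x₂-d₂    : Edge G x₂ d₂
        c≢d₁     : c ≢ d₁
        c≢d₂     : c ≢ d₂
        d₁≢d₂    : d₁ ≢ d₂
        upper-c  : Upper c
        upper-d₁ : Upper d₁
        upper-d₂ : Upper d₂

    shared-of-missed : ∀ {x₁ x₂ p q} → EarlyNeighbour x₂ → Edge G x₁ p → Edge G x₁ q → p ≢ q →
                       Upper p → Upper q → ¬ Edge G x₂ p → Shared x₁ x₂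
    shared-of-missed record { x-a = x-a ; x-b = x-b ; a≢b = a≢b ; upper-a = ua ; upper-b = ub }
                     x₁p x₁q p≢q up uq ¬x₂p
      with upper-covered up ua ub (non-neighbour≢neighbour ¬x₂p x-a) (non-neighbour≢neighbour ¬x₂p x-b) a≢b uq
    ... | here refl                 = ⊥-elim (p≢q refl)
    ... | there (here refl)         = record
      { x₁-c = x₁q ; x₁-d₁ = x₁p ; x₂-c = x-a ; x₂-d₂ = x-b
      ; c≢d₁ = p≢q ∘ ≡.sym ; c≢d₂ = a≢b ; d₁≢d₂ = non-neighbour≢neighbour ¬x₂p x-b
      ; upper-c = uq ; upper-d₁ = up ; upper-d₂ = ub }
    ... | there (there (here refl)) = record
      { x₁-c = x₁q ; x₁-d₁ = x₁p ; x₂-c = x-b ; x₂-d₂ = x-a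
      ; c≢d₁ = p≢q ∘ ≡.sym ; c≢d₂ = a≢b ∘ ≡.sym ; d₁≢d₂ = non-neighbour≢neighbour ¬x₂p x-a
      ; upper-c = uq ; upper-d₁ = up ; upper-d₂ = ua }

    K23-or-shared : ∀ {x₁ x₂} → EarlyNeighbour x₁ → EarlyNeighbour x₂ → x₁ ≢ x₂ →
                    TriangleK23OrDomino G ⊎ Shared x₁ x₂
    K23-or-shared {x₂ = x₂}
                  e₁@record { a = a ; b = b ; x-a = x-a ; x-b = x-b ; a≢b = a≢b ; upper-a = ua ; upper-b = ub }
                  e₂ x₁≢x₂
      with Edge? x₂ a | Edge? x₂ b
    ... | yes x₂a | yes x₂b = inj₁ (K23-at-w e₁ e₂ x₁≢x₂ x-a x-b x₂a x₂b ua ub a≢b)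
    ... | no ¬x₂a | _       = inj₂ (shared-of-missed e₂ x-a x-b a≢b ua ub ¬x₂a)
    ... | yes _   | no ¬x₂b = inj₂ (shared-of-missed e₂ x-b x-a (a≢b ∘ ≡.sym) ub ua ¬x₂b)

    one-early : ∀ {x y z} → EarlyNeighbour x → Edge G w y → Edge G w z → rank w < rank y → rank w < rank z →
                y ≢ z → TriangleK23OrDomino G
    one-early {x} {y} record { adjacent = wx ; x-a = x-a ; x-b = x-b ; a≢b = a≢b ; upper-a = ua ; upper-b = ub }
              wy wz w<y w<z y≢z
      with Edge? x y
    ... | yes xy = triangle wx xy wy
    ... | no ¬xy with upper-covered (late-neighbour-upper wy w<y) ua ub
                        (non-neighbour≢neighbour ¬xy x-a) (non-neighbour≢neighbour ¬xy x-b) a≢b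
                        (late-neighbour-upper wz w<z)
    ...   | here refl                 = ⊥-elim (y≢z refl)
    ...   | there (here refl)         = triangle wx x-a wz
    ...   | there (there (here refl)) = triangle wx x-b wz

    two-early : ∀ {x₁ x₂ y} → EarlyNeighbour x₁ → EarlyNeighbour x₂ → x₁ ≢ x₂ → Edge G w y → rank w < rank y →
                TriangleK23OrDomino G
    two-early {x₁} {x₂} {y}
              e₁@record { adjacent = wx₁ ; a = a ; b = b ; x-a = x₁a ; x-b = x₁b ; a≢b = a≢b ; upper-a = ua ; upper-b = ub }
              e₂ x₁≢x₂ wy w<y
      with Edge? x₁ y | Edge? x₂ y
    ... | yes x₁y | _       = triangle wx₁ x₁y wy
    ... | no _    | yes x₂y = triangle (EarlyNeighbour.adjacent e₂) x₂y wy
    ... | no ¬x₁y | no ¬x₂y = K23-at-w e₁ e₂ x₁≢x₂ x₁a x₁b (proj₁ x₂-hits) (proj₂ x₂-hits) ua ub a≢b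
      where
      x₂-hits : Edge G x₂ a × Edge G x₂ b
      x₂-hits = misses-one⇒hits-others e₂ (late-neighbour-upper wy w<y) ua ub
                  (non-neighbour≢neighbour ¬x₁y x₁a) (non-neighbour≢neighbour ¬x₁y x₁b) a≢b ¬x₂y

    three-early : ∀ {x₁ x₂ x₃} → EarlyNeighbour x₁ → EarlyNeighbour x₂ → EarlyNeighbour x₃ →
                  x₁ ≢ x₂ → x₁ ≢ x₃ → x₂ ≢ x₃ → TriangleK23OrDomino G
    three-early {x₃ = x₃} e₁ e₂ e₃ x₁≢x₂ x₁≢x₃ x₂≢x₃ with K23-or-shared e₁ e₂ x₁≢x₂
    ... | inj₁ found = found
    ... | inj₂ record { c = c ; d₁ = d₁ ; d₂ = d₂ ; x₁-c = x₁c ; x₁-d₁ = x₁d₁ ; x₂-c = x₂c ; x₂-d₂ = x₂d₂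
                      ; c≢d₁ = c≢d₁ ; c≢d₂ = c≢d₂ ; d₁≢d₂ = d₁≢d₂ ; upper-c = uc ; upper-d₁ = ud₁ ; upper-d₂ = ud₂ }
      with Edge? x₃ c | Edge? x₃ d₁
    ... | no ¬x₃c | _ =
      domino x₂c (Edge-sym (adjacent e₂)) (Edge-sym x₁c) (adjacent e₁) (adjacent e₃) x₁d₁ x₃d₁
             x₂≢x₃ (early≢upper (early e₂) ud₁) (x₁≢x₂ ∘ ≡.sym) (early≢upper (early e₃) uc ∘ ≡.sym) c≢d₁
             (w≢upper uc ∘ ≡.sym) (x₁≢x₃ ∘ ≡.sym) (w≢upper ud₁ ∘ ≡.sym)
      where
      open EarlyNeighbour
      x₃d₁ : Edge G x₃ d₁
      x₃d₁ = proj₁ (misses-one⇒hits-others e₃ uc ud₁ ud₂ c≢d₁ c≢d₂ d₁≢d₂ ¬x₃c)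
    ... | yes x₃c | yes x₃d₁ = K23-at-w e₁ e₃ x₁≢x₃ x₁c x₁d₁ x₃c x₃d₁ uc ud₁ c≢d₁
    ... | yes x₃c | no ¬x₃d₁ = K23-at-w e₂ e₃ x₂≢x₃ x₂c x₂d₂ x₃c x₃d₂ uc ud₂ c≢d₂
      where
      x₃d₂ : Edge G x₃ d₂
      x₃d₂ = proj₂ (misses-one⇒hits-others e₃ ud₁ uc ud₂ (c≢d₁ ∘ ≡.sym) d₁≢d₂ c≢d₂ ¬x₃d₁)

    classify : ∀ {y} → Edge G w y → EarlyNeighbour y ⊎ rank w < rank y
    classify {y} wy with <-cmp (rank y) (rank w)
    ... | tri< y<w _ _ = inj₁ (early-neighbour y<w wy)
    ... | tri≈ _ y≡w _ = ⊥-elim (Edge⇒≢ wy (≡.sym (rank-injective y≡w)))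
    ... | tri> _ _ w<y = inj₂ w<y

    conclusion : ∀ {x₀} → Early x₀ → x₀ ~ w → TriangleK23OrDomino G
    conclusion {x₀} x₀<w x₀~w = by-cases (size≡3⇒TwoOthers {S = adj G w} (cubic w) wx₀)
      where
      wx₀ : Edge G w x₀
      wx₀ = Edge-sym (early-~⇒Edge x₀<w x₀~w)
      e₀ : EarlyNeighbour x₀
      e₀ = early-neighbour x₀<w wx₀
      by-cases : TwoOthers (Edge G w) x₀ → TriangleK23OrDomino G
      by-cases record { Pa = wa ; Pb = wb ; u≢a = x₀≢a ; u≢b = x₀≢b ; a≢b = a≢b } with classify wa | classify wb
      ... | inj₁ ea  | inj₁ eb  = three-early e₀ ea eb x₀≢a x₀≢b a≢b
      ... | inj₁ ea  | inj₂ w<b = two-early e₀ ea x₀≢a wb w<b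
      ... | inj₂ w<a | inj₁ eb  = two-early e₀ eb x₀≢b wa w<a
      ... | inj₂ w<a | inj₂ w<b = one-early e₀ wa wb w<a w<b a≢b

  HasPredecessor? : ∀ w → Dec (HasPredecessor w)
  HasPredecessor? w = any? (λ x → (rank x <? rank w) ×-dec (x ~? w))

  predecessor-exists : Fin n → ∃ HasPredecessor
  predecessor-exists v with nonempty {S = adj G v} (cubic v)
  ... | u , vu with <-cmp (rank v) (rank u)
  ...   | tri< v<u _ _ = u , v , v<u , Edge⇒~ vu
  ...   | tri≈ _ v≡u _ = ⊥-elim (Edge⇒≢ vu (rank-injective v≡u))
  ...   | tri> _ _ u<v = v , u , u<v , Edge⇒~ (Edge-sym vu)

  first-with-predecessor : Fin n → ∃ λ w → HasPredecessor w × (∀ {v} → HasPredecessor v → rank w ≤ rank v)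
  first-with-predecessor v with predecessor-exists v
  ... | v₀ , pred₀ = w , argmin-all rank pred₀ (all-filter HasPredecessor? (allFin n)) , minimal
    where
    candidates : List (Fin n)
    candidates = filter HasPredecessor? (allFin n)
    w : Fin n
    w = argmin rank v₀ candidates
    minimal : ∀ {u} → HasPredecessor u → rank w ≤ rank u
    minimal pred = All.lookup (f[argmin]≤f[xs] v₀ candidates) (∈-filter⁺ HasPredecessor? (∈-allFin _) pred)

  cubic-elimination⇒TriangleK23OrDomino : Fin n → TriangleK23OrDomino G
  cubic-elimination⇒TriangleK23OrDomino v with first-with-predecessor v
  ... | w , (x₀ , x₀<w , x₀~w) , first = FirstWithPredecessor.conclusion w first x₀<w x₀~w

lemma28 : ∀ {n} (G : Graph (suc n)) → Cubic G → TreeWidthAtMost G 3 → ContainsCopy G 3 triangleEdges ⊎ ContainsCopy G 5 K23Edges ⊎ ContainsCopy G 6 dominoEdges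
lemma28 G cubic (_ , D , width) =
  cubic-elimination⇒TriangleK23OrDomino cubic (treeDecomposition⇒EliminationOrdering D width) zero
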